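{- Let $n\ge2$, $\mathbf c\in\mathbb Z_{\ge0}^n$, and let $M$ be a proper $\mathbf c$-multicomplex. Suppose that both $\{x_1^{(c_1)}\}$ and $\{x_n^{(0)}\}$ are faces of $\mathrm{Bier}_{\mathbf c}(M)$. Then $\{x_1^{(c_1)},x_n^{(0)}\}\in\mathrm{Bier}_{\mathbf c}(M)$, and $\mathrm{Bier}_{\mathbf c}(M)$ satisfies the Link condition with respect to $\{x_1^{(c_1)},x_n^{(0)}\}$.
   Context: For $\mathbf c=(c_1,\dots,c_n)\in\mathbb Z_{\ge0}^n$ write $x^{\mathbf a}=x_1^{a_1}\cdots x_n^{a_n}$. A $\mathbf c$-monomial is $x^{\mathbf a}$ with $a_i\le c_i$ for all $i$. A $\mathbf c$-multicomplex is a nonempty set $M$ of $\mathbf c$-monomials closed under taking divisors, proper if it is not the set of all $\mathbf c$-monomials. Let $\widetilde X=\{x_i^{(j)}:1\le i\le n,0\le j\le c_i\}$ (new symbols), $F_{\mathbf c}(x^{\mathbf a})=\widetilde X\setminus\{x_1^{(a_1)},\dots,x_n^{(a_n)}\}$, and $\mathcal B_{\mathbf c}(M)$ the simplicial complex of all subsets of the sets $F_{\mathbf c}(x^{\mathbf a})$, $x^{\mathbf a}\in M$. For a pure $(d-1)$-dimensional complex $B$, $\partial B$ is the complex generated by the $(d-1)$-element faces lying in exactly one facet; for proper $M$, $\mathrm{Bier}_{\mathbf c}(M)=\partial\mathcal B_{\mathbf c}(M)$. For a simplicial complex $\Delta$ on $V$, $\mathrm{lk}_\Delta(F)=\{G\subset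 V\setminus F:G\cup F\in\Delta\}$, and $\Delta$ satisfies the Link condition w.r.t. $\{i,j\}$ if $\mathrm{lk}_\Delta(\{i\})\cap\mathrm{lk}_\Delta(\{j\})=\mathrm{lk}_\Delta(\{i,j\})$. -}

module Defs where

open import Data.Nat using (ℕ; zero; suc; _∸_; _≤_)
open import Data.Fin using (Fin; toℕ)
import Data.Fin.Properties as FinP
open import Data.Bool using (Bool; true; false; not; _∨_)
open import Data.List using (List; length; filter; concatMap; map; allFin; []; _∷_)
open import Data.Product using (Σ; _×_; _,_)
import Data.Product.Properties as ProdP
open import Data.Empty using (⊥)
open import Relation.Nullary using (¬_; Dec)
open import Relation.Nullary.Decidable using (⌊_⌋)
open import Relation.Binary.PropositionalEquality using (_≡_)
open import Relation.Binary.Definitions using (DecidableEquality)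

-- All notions below depend only on
-- membership, so they respect pointwise equality of faces.

module _ {V : Set} where

  Face : Set
  Face = V → Bool

  _∈ᶠ_ : V → Face → Set
  v ∈ᶠ F = F v ≡ true

  _⊆ᶠ_ : Face → Face → Set
  F ⊆ᶠ G = ∀ v → v ∈ᶠ F → v ∈ᶠ G

  _≐_ : Face → Face → Set
  F ≐ G = (F ⊆ᶠ G) × (G ⊆ᶠ F)

  _∪ᶠ_ : Face → Face → Face
  (F ∪ᶠ G) v = F v ∨ G v

  Disjoint : Face → Face → Set
  Disjoint F G = ∀ v → v ∈ᶠ F → v ∈ᶠ G → ⊥

  singleton : DecidableEquality V → V → Face
  singleton eq v w = ⌊ eq w v ⌋

  Complex : Set₁
  Complex = Face → Set

  card : List V → Face → ℕ
  card enum F = length (filter (λ v → F v ≡? true) enum)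
    where
    _≡?_ : (a b : Bool) → Dec (a ≡ b)
    _≡?_ = Data.Bool._≟_
      where import Data.Bool

  IsFacet : Complex → Face → Set
  IsFacet Δ F = Δ F × (∀ G → Δ G → F ⊆ᶠ G → G ⊆ᶠ F)

  -- ∂Δ for a pure complex whose facets have d elements:
  -- generated by the (d-1)-element faces lying in exactly one facet.
  Boundary : List V → ℕ → Complex → Complex
  Boundary enum d Δ G =
    Σ Face λ R → Δ R × (card enum R ≡ d ∸ 1) × (G ⊆ᶠ R) ×
      (Σ Face λ F → IsFacet Δ F × (R ⊆ᶠ F) ×
         (∀ F′ → IsFacet Δ F′ → R ⊆ᶠ F′ → F′ ≐ F))

  Link : Complex → Face → Complex
  Link Δ F G = Disjoint G F × Δ (G ∪ᶠ F)

  LinkCondition : DecidableEquality V → Complex → V → V → Set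
  LinkCondition eq Δ u w =
    ∀ G → ((Link Δ (singleton eq u) G × Link Δ (singleton eq w) G) →
             Link Δ (singleton eq u ∪ᶠ singleton eq w) G)
        × (Link Δ (singleton eq u ∪ᶠ singleton eq w) G →
             (Link Δ (singleton eq u) G × Link Δ (singleton eq w) G))

-- x^a with a_i ≤ c_i, represented by its exponent vector
Mono : (n : ℕ) → (Fin n → ℕ) → Set
Mono n c = (i : Fin n) → Fin (suc (c i))

_∣ᵐ_ : {n : ℕ} {c : Fin n → ℕ} → Mono n c → Mono n c → Set
b ∣ᵐ a = ∀ i → toℕ (b i) ≤ toℕ (a i)

record IsMulticomplex {n : ℕ} {c : Fin n → ℕ} (M : Mono n c → Set) : Set where
  field
    nonempty : Σ (Mono n c) M
    closed   : ∀ a b → M a → b ∣ᵐ a → M b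
    decide   : ∀ a → Dec (M a)

Proper : {n : ℕ} {c : Fin n → ℕ} → (Mono n c → Set) → Set
Proper {n} {c} M = Σ (Mono n c) λ a → ¬ M a

-- the vertex x_i^{(j)} is the pair (i , j), 0 ≤ j ≤ c_i
Vtx : (n : ℕ) → (Fin n → ℕ) → Set
Vtx n c = Σ (Fin n) λ i → Fin (suc (c i))

Vtx-dec : {n : ℕ} {c : Fin n → ℕ} → DecidableEquality (Vtx n c)
Vtx-dec = ProdP.≡-dec FinP._≟_ FinP._≟_

⁅_⁆ : {n : ℕ} {c : Fin n → ℕ} → Vtx n c → Face {Vtx n c}
⁅_⁆ = singleton Vtx-dec

allVtx : (n : ℕ) (c : Fin n → ℕ) → List (Vtx n c)
allVtx n c = concatMap (λ i → map (λ j → (i , j)) (allFin (suc (c i)))) (allFin n)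

-- F_c(x^a) = X̃ ∖ {x_1^{(a_1)}, …, x_n^{(a_n)}}
Fc : {n : ℕ} {c : Fin n → ℕ} → Mono n c → Face {Vtx n c}
Fc a (i , j) = not ⌊ j FinP.≟ a i ⌋

Bcx : {n : ℕ} {c : Fin n → ℕ} → (Mono n c → Set) → Complex {Vtx n c}
Bcx M G = Σ _ λ a → M a × (G ⊆ᶠ Fc a)

-- Bier_c(M) = ∂ 𝓑_c(M); 𝓑_c(M) is pure with facets of size |X̃| - n
Bier : (n : ℕ) (c : Fin n → ℕ) → (Mono n c → Set) → Complex {Vtx n c}
Bier n c M = Boundary (allVtx n c) (length (allVtx n c) ∸ n) (Bcx M)

BierLinkCondition : (n : ℕ) (c : Fin n → ℕ) → (Mono n c → Set) → Vtx n c → Vtx n c → Set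
BierLinkCondition n c M u w = LinkCondition Vtx-dec (Bier n c M) u w

module Submission where

-- A BRIDGE for a face G is a pair a ∈ M, b ∉ M of monomials differing in exactly one
-- coordinate with G ⊆ F_c(a) ∩ F_c(b).  The faces of Bier_c(M) are exactly the faces with
-- a bridge: F_c(a) ∩ F_c(b) has one vertex fewer than a facet and lies in the single
-- facet F_c(a) (Bridge⇒Bier); conversely, a ridge R ⊂ F_c(a) lying in one facet only
-- misses some vertex (i , j) of F_c(a), and moving a_i to j leaves M (Bier⇒Bridge).
-- Avoiding the graph of a monomial is preserved when each exponent is taken from one of
-- two avoiding monomials, so walking from e ∈ M to f ∉ M one coordinate at a time yields
-- a bridge for every face avoided by both (bridge-between).  From bridges for G ∪ {u}
-- and G ∪ {w} we build such e and f avoiding G ∪ {u, w} (join-bridges): this gives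
-- lk(u) ∩ lk(w) ⊆ lk({u, w}), while the reverse inclusion holds in every complex closed
-- under subsets.

open import Defs
open import Data.Nat using (ℕ; zero; suc; _+_; _∸_; _≤_; _<_; z≤n; s≤s; _≤?_; _<?_)
open import Data.Nat.Properties
  using (module ≤-Reasoning; +-suc; m+n∸n≡m; m+n∸m≡n; ∸-monoʳ-<; ≤-reflexive; ≤-refl; ≤-trans;
         ≤-antisym; ≤-pred; n≤1+n; ≮⇒≥; ≰⇒>; <⇒≤)
open import Data.Fin using (Fin; zero; toℕ; fromℕ; fromℕ<)
import Data.Fin.Properties as FinP
open import Data.Bool using (Bool; true; false; not; _∨_; _∧_)
open import Data.Bool.Properties using (∧-idem; ∧-identityʳ)
open import Data.List using (List; []; _∷_; _++_; length; map; concatMap; allFin; [_])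
open import Data.List.Properties using (concatMap-pure; length-tabulate)
open import Data.List.Membership.Propositional using (_∈_)
open import Data.List.Membership.Propositional.Properties using (∈-allFin; ∈-map⁺; ∈-concatMap⁺)
open import Data.List.Relation.Unary.All using (All; []; _∷_)
open import Data.List.Relation.Unary.Any using (here; there)
import Data.List.Relation.Unary.Any as Any
open import Data.List.Relation.Unary.Unique.Propositional using (Unique; []; _∷_)
open import Data.List.Relation.Unary.Unique.Propositional.Properties using (allFin⁺)
open import Data.Product using (Σ; _×_; _,_; proj₁; proj₂)
open import Data.Sum using (_⊎_; inj₁; inj₂) renaming (map to ⊎-map)
open import Relation.Nullary using (¬_; Dec; yes; no; contradiction)
open import Relation.Nullary.Decidable using (⌊_⌋; dec-true; dec-false; isYes≗does)
open import Relation.Binary.PropositionalEquality using (_≡_; _≢_; refl; sym; trans; cong; cong₂; subst; module ≡-Reasoning)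
open import Relation.Binary.Definitions using (DecidableEquality)

module _ {P : Set} where

  ⌊⌋-true : (p? : Dec P) → P → ⌊ p? ⌋ ≡ true
  ⌊⌋-true p? p = trans (isYes≗does p?) (dec-true p? p)

  ⌊⌋-false : (p? : Dec P) → ¬ P → ⌊ p? ⌋ ≡ false
  ⌊⌋-false p? ¬p = trans (isYes≗does p?) (dec-false p? ¬p)

  ⌊⌋-sound : (p? : Dec P) → ⌊ p? ⌋ ≡ true → P
  ⌊⌋-sound (yes p) _ = p

∨-elim : (x y : Bool) → x ∨ y ≡ true → x ≡ true ⊎ y ≡ true
∨-elim true  y _ = inj₁ refl
∨-elim false y e = inj₂ e

module Counting {A : Set} where

  card-++ : (xs ys : List A) (F : Face {A}) → card (xs ++ ys) F ≡ card xs F + card ys F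
  card-++ [] ys F = refl
  card-++ (x ∷ xs) ys F with F x
  ... | true  = cong suc (card-++ xs ys F)
  ... | false = card-++ xs ys F

  card-map : {B : Set} (h : B → A) (xs : List B) (F : Face {A}) →
             card (map h xs) F ≡ card xs (λ y → F (h y))
  card-map h [] F = refl
  card-map h (x ∷ xs) F with F (h x)
  ... | true  = cong suc (card-map h xs F)
  ... | false = card-map h xs F

  card-ext : (xs : List A) {F G : Face {A}} → (∀ x → F x ≡ G x) → card xs F ≡ card xs G
  card-ext [] eq = refl
  card-ext (x ∷ xs) {F} {G} eq with F x | G x | eq x
  ... | true  | .true  | refl = cong suc (card-ext xs eq)
  ... | false | .false | refl = card-ext xs eq

  card-all : (xs : List A) → card xs (λ _ → true) ≡ length xs
  card-all [] = refl
  card-all (x ∷ xs) = cong suc (card-all xs)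

  card-none : (xs : List A) → card xs (λ _ → false) ≡ 0
  card-none [] = refl
  card-none (x ∷ xs) = card-none xs

  card-complement : (xs : List A) (F : Face {A}) →
                    card xs F + card xs (λ x → not (F x)) ≡ length xs
  card-complement [] F = refl
  card-complement (x ∷ xs) F with F x
  ... | true  = cong suc (card-complement xs F)
  ... | false = trans (+-suc _ _) (cong suc (card-complement xs F))

  card-witness : (xs : List A) (F G : Face {A}) → card xs F < card xs G →
                 Σ A λ x → G x ≡ true × F x ≡ false
  card-witness [] F G ()
  card-witness (x ∷ xs) F G lt with F x in Fx | G x in Gx
  ... | false | true  = x , Gx , Fx
  ... | true  | true  = card-witness xs F G (≤-pred lt)
  ... | false | false = card-witness xs F G lt
  ... | true  | false = card-witness xs F G (≤-trans (n≤1+n _) lt)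

  card-pos : {xs : List A} {x : A} (F : Face {A}) → x ∈ xs → F x ≡ true → 0 < card xs F
  card-pos {x ∷ xs} F (here refl) Fx rewrite Fx = s≤s z≤n
  card-pos {y ∷ xs} F (there x∈) Fx with F y
  ... | true  = s≤s z≤n
  ... | false = card-pos F x∈ Fx

  module _ (_≟_ : DecidableEquality A) where

    card-absent : (xs : List A) {p : A} → All (p ≢_) xs → card xs (λ x → ⌊ x ≟ p ⌋) ≡ 0
    card-absent [] [] = refl
    card-absent (x ∷ xs) {p} (p≢x ∷ ps) with x ≟ p
    ... | yes refl = contradiction refl p≢x
    ... | no _     = card-absent xs ps

    card-point : {xs : List A} {p : A} → Unique xs → p ∈ xs → card xs (λ x → ⌊ x ≟ p ⌋) ≡ 1
    card-point {x ∷ xs} {p} (x∉ ∷ u) p∈ with x ≟ p | p∈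
    ... | yes refl | _         = cong suc (card-absent xs x∉)
    ... | no x≢p   | here p≡x  = contradiction (sym p≡x) x≢p
    ... | no _     | there p∈′ = card-point u p∈′

    card-remove : (xs : List A) (F : Face {A}) {p : A} → F p ≡ true →
      card xs (λ x → F x ∧ not ⌊ x ≟ p ⌋) + card xs (λ x → ⌊ x ≟ p ⌋) ≡ card xs F
    card-remove [] F Fp = refl
    card-remove (x ∷ xs) F {p} Fp with x ≟ p
    ... | yes refl rewrite Fp = trans (+-suc _ _) (cong suc (card-remove xs F Fp))
    ... | no _ with F x
    ...   | true  = cong suc (card-remove xs F Fp)
    ...   | false = card-remove xs F Fp

card-concatMap : {A B C : Set} (f : B → List A) (g : B → List C) (F : Face {A}) (G : Face {C}) →
  (∀ y → card (f y) F ≡ card (g y) G) → (ys : List B) →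
  card (concatMap f ys) F ≡ card (concatMap g ys) G
card-concatMap f g F G blocks [] = refl
card-concatMap f g F G blocks (y ∷ ys) = begin
  card (f y ++ concatMap f ys) F             ≡⟨ Counting.card-++ (f y) _ F ⟩
  card (f y) F + card (concatMap f ys) F     ≡⟨ cong₂ _+_ (blocks y) (card-concatMap f g F G blocks ys) ⟩
  card (g y) G + card (concatMap g ys) G     ≡⟨ sym (Counting.card-++ (g y) _ G) ⟩
  card (g y ++ concatMap g ys) G             ∎
  where open ≡-Reasoning

module _ {n : ℕ} {c : Fin n → ℕ} where
  open Counting

  block : Fin n → List (Vtx n c)
  block i = map (i ,_) (allFin (suc (c i)))

  ∈-allVtx : (v : Vtx n c) → v ∈ allVtx n c
  ∈-allVtx (i , j) =
    ∈-concatMap⁺ block (Any.map (λ { refl → ∈-map⁺ (i ,_) (∈-allFin j) }) (∈-allFin i))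

  card-allVtx : (F : Face {Vtx n c}) (P : Fin n → Bool) →
    (∀ i → card (allFin (suc (c i))) (λ j → F (i , j)) ≡ card [ i ] P) →
    card (allVtx n c) F ≡ card (allFin n) P
  card-allVtx F P blocks = begin
    card (concatMap block (allFin n)) F  ≡⟨ card-concatMap block [_] F P blockwise (allFin n) ⟩
    card (concatMap [_] (allFin n)) P    ≡⟨ cong (λ is → card is P) (concatMap-pure (allFin n)) ⟩
    card (allFin n) P                    ∎
    where
    open ≡-Reasoning
    blockwise : ∀ i → card (block i) F ≡ card [ i ] P
    blockwise i = trans (card-map (i ,_) (allFin (suc (c i))) F) (blocks i)

  graph : Mono n c → Face {Vtx n c}
  graph a (i , j) = ⌊ j FinP.≟ a i ⌋

  -- The graph meets every block in exactly one vertex.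
  card-graph : (a : Mono n c) → card (allVtx n c) (graph a) ≡ n
  card-graph a = begin
    card (allVtx n c) (graph a)      ≡⟨ card-allVtx (graph a) (λ _ → true) once ⟩
    card (allFin n) (λ _ → true)     ≡⟨ card-all (allFin n) ⟩
    length (allFin n)                ≡⟨ length-tabulate (λ i → i) ⟩
    n                                ∎
    where
    open ≡-Reasoning
    once : ∀ i → card (allFin (suc (c i))) (λ j → ⌊ j FinP.≟ a i ⌋) ≡ 1
    once i = card-point FinP._≟_ (allFin⁺ _) (∈-allFin (a i))

  card-Fc : (a : Mono n c) → card (allVtx n c) (Fc a) ≡ length (allVtx n c) ∸ n
  card-Fc a = begin
    card (allVtx n c) (Fc a)                                  ≡⟨ sym (m+n∸m≡n n _) ⟩
    n + card (allVtx n c) (Fc a) ∸ n                          ≡⟨ cong (λ k → k + card (allVtx n c) (Fc a) ∸ n) (sym (card-graph a)) ⟩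
    card (allVtx n c) (graph a) + card (allVtx n c) (Fc a) ∸ n ≡⟨ cong (_∸ n) (card-complement (allVtx n c) (graph a)) ⟩
    length (allVtx n c) ∸ n                                   ∎
    where open ≡-Reasoning

  ⁅⁆-fibre : (i : Fin n) (j j′ : Fin (suc (c i))) → ⁅_⁆ {c = c} (i , j′) (i , j) ≡ ⌊ j FinP.≟ j′ ⌋
  ⁅⁆-fibre i j j′ with j FinP.≟ j′
  ... | yes refl = ⌊⌋-true (Vtx-dec (i , j) (i , j)) refl
  ... | no j≢j′  = ⌊⌋-false (Vtx-dec (i , j) (i , j′)) (λ { refl → j≢j′ refl })

  ⁅⁆-off : (p : Vtx n c) (i : Fin n) (j : Fin (suc (c i))) → i ≢ proj₁ p → ⁅ p ⁆ (i , j) ≡ false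
  ⁅⁆-off p i j i≢ = ⌊⌋-false (Vtx-dec (i , j) p) (λ e → i≢ (cong proj₁ e))

  card-vertex : (p : Vtx n c) → card (allVtx n c) ⁅ p ⁆ ≡ 1
  card-vertex p = begin
    card (allVtx n c) ⁅ p ⁆                     ≡⟨ card-allVtx ⁅ p ⁆ (λ i → ⌊ i FinP.≟ i₀ ⌋) blockwise ⟩
    card (allFin n) (λ i → ⌊ i FinP.≟ i₀ ⌋)    ≡⟨ card-point FinP._≟_ (allFin⁺ n) (∈-allFin i₀) ⟩
    1                                           ∎
    where
    open ≡-Reasoning
    i₀ : Fin n
    i₀ = proj₁ p
    j₀ : Fin (suc (c i₀))
    j₀ = proj₂ p
    BlockCount : Fin n → Set
    BlockCount i = card (allFin (suc (c i))) (λ j → ⁅ p ⁆ (i , j)) ≡ card [ i ] (λ i → ⌊ i FinP.≟ i₀ ⌋)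
    blockwise′ : ∀ i → Dec (i ≡ i₀) → BlockCount i
    blockwise′ i (yes refl) = begin
      card (allFin (suc (c i₀))) (λ j → ⁅ p ⁆ (i₀ , j))  ≡⟨ card-ext (allFin (suc (c i₀))) (λ j → ⁅⁆-fibre i₀ j j₀) ⟩
      card (allFin (suc (c i₀))) (λ j → ⌊ j FinP.≟ j₀ ⌋) ≡⟨ card-point FinP._≟_ (allFin⁺ _) (∈-allFin j₀) ⟩
      1                                                  ≡⟨ sym (card-point FinP._≟_ {p = i₀} ([] ∷ []) (here refl)) ⟩
      card [ i₀ ] (λ i → ⌊ i FinP.≟ i₀ ⌋)               ∎
    blockwise′ i (no i≢i₀) = begin
      card (allFin (suc (c i))) (λ j → ⁅ p ⁆ (i , j))  ≡⟨ card-ext (allFin (suc (c i))) (λ j → ⁅⁆-off p i j i≢i₀) ⟩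
      card (allFin (suc (c i))) (λ _ → false)         ≡⟨ card-none (allFin (suc (c i))) ⟩
      0                                                ≡⟨ sym (card-absent FinP._≟_ [ i ] ((λ e → i≢i₀ (sym e)) ∷ [])) ⟩
      card [ i ] (λ i → ⌊ i FinP.≟ i₀ ⌋)              ∎
    blockwise : ∀ i → BlockCount i
    blockwise i = blockwise′ i (i FinP.≟ i₀)

module _ {k : ℕ} where

  _⊓ᶠ_ _⊔ᶠ_ : Fin k → Fin k → Fin k
  x ⊓ᶠ y with toℕ x ≤? toℕ y
  ... | yes _ = x
  ... | no _  = y
  x ⊔ᶠ y with toℕ x ≤? toℕ y
  ... | yes _ = y
  ... | no _  = x

  ⊓ᶠ-either : (x y : Fin k) → x ⊓ᶠ y ≡ x ⊎ x ⊓ᶠ y ≡ y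
  ⊓ᶠ-either x y with toℕ x ≤? toℕ y
  ... | yes _ = inj₁ refl
  ... | no _  = inj₂ refl

  ⊔ᶠ-either : (x y : Fin k) → x ⊔ᶠ y ≡ x ⊎ x ⊔ᶠ y ≡ y
  ⊔ᶠ-either x y with toℕ x ≤? toℕ y
  ... | yes _ = inj₂ refl
  ... | no _  = inj₁ refl

  ⊓ᶠ-≤ˡ : (x y : Fin k) → toℕ (x ⊓ᶠ y) ≤ toℕ x
  ⊓ᶠ-≤ˡ x y with toℕ x ≤? toℕ y
  ... | yes _   = ≤-refl
  ... | no x≰y  = <⇒≤ (≰⇒> x≰y)

  ⊓ᶠ-≤ʳ : (x y : Fin k) → toℕ (x ⊓ᶠ y) ≤ toℕ y
  ⊓ᶠ-≤ʳ x y with toℕ x ≤? toℕ y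
  ... | yes x≤y = x≤y
  ... | no _    = ≤-refl

  ⊔ᶠ-≥ˡ : (x y : Fin k) → toℕ x ≤ toℕ (x ⊔ᶠ y)
  ⊔ᶠ-≥ˡ x y with toℕ x ≤? toℕ y
  ... | yes x≤y = x≤y
  ... | no _    = ≤-refl

  ⊔ᶠ-≥ʳ : (x y : Fin k) → toℕ y ≤ toℕ (x ⊔ᶠ y)
  ⊔ᶠ-≥ʳ x y with toℕ x ≤? toℕ y
  ... | yes _   = ≤-refl
  ... | no x≰y  = <⇒≤ (≰⇒> x≰y)

below-top : {k : ℕ} (x y : Fin (suc k)) → toℕ y ≤ toℕ x → fromℕ k ≢ x → fromℕ k ≢ y
below-top x y y≤x top≢x refl = top≢x (FinP.≤-antisym y≤x (FinP.≤fromℕ x))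

above-zero : {k : ℕ} (x y : Fin (suc k)) → toℕ x ≤ toℕ y → zero ≢ x → zero ≢ y
above-zero x y x≤y zero≢x refl = zero≢x (FinP.≤-antisym {i = zero} z≤n x≤y)

module _ {V : Set} where

  ⊆-∪ˡ : (G H : Face {V}) → G ⊆ᶠ (G ∪ᶠ H)
  ⊆-∪ˡ G H v Gv rewrite Gv = refl

  ⊆-∪ʳ : (G H : Face {V}) → H ⊆ᶠ (G ∪ᶠ H)
  ⊆-∪ʳ G H v Hv rewrite Hv with G v
  ... | true  = refl
  ... | false = refl

  ∪-⊆ : (G H K : Face {V}) → G ⊆ᶠ K → H ⊆ᶠ K → (G ∪ᶠ H) ⊆ᶠ K
  ∪-⊆ G H K G⊆K H⊆K v GHv with ∨-elim (G v) (H v) GHv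
  ... | inj₁ Gv = G⊆K v Gv
  ... | inj₂ Hv = H⊆K v Hv

  ∪-disjoint : (G H K : Face {V}) → Disjoint G H → Disjoint G K → Disjoint G (H ∪ᶠ K)
  ∪-disjoint G H K G#H G#K v Gv HKv with ∨-elim (H v) (K v) HKv
  ... | inj₁ Hv = G#H v Gv Hv
  ... | inj₂ Kv = G#K v Gv Kv

  Link-∪⁻ : (Δ : Complex {V}) → (∀ G G′ → G ⊆ᶠ G′ → Δ G′ → Δ G) →
            ∀ H K G → Link Δ (H ∪ᶠ K) G → Link Δ H G × Link Δ K G
  Link-∪⁻ Δ Δ-⊆ H K G (G#HK , ΔGHK) =
    ((λ v Gv Hv → G#HK v Gv (⊆-∪ˡ H K v Hv)) , Δ-⊆ (G ∪ᶠ H) (G ∪ᶠ (H ∪ᶠ K)) GH⊆ ΔGHK) ,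
    ((λ v Gv Kv → G#HK v Gv (⊆-∪ʳ H K v Kv)) , Δ-⊆ (G ∪ᶠ K) (G ∪ᶠ (H ∪ᶠ K)) GK⊆ ΔGHK)
    where
    GH⊆ : (G ∪ᶠ H) ⊆ᶠ (G ∪ᶠ (H ∪ᶠ K))
    GH⊆ = ∪-⊆ G H _ (⊆-∪ˡ G (H ∪ᶠ K)) (λ v Hv → ⊆-∪ʳ G (H ∪ᶠ K) v (⊆-∪ˡ H K v Hv))
    GK⊆ : (G ∪ᶠ K) ⊆ᶠ (G ∪ᶠ (H ∪ᶠ K))
    GK⊆ = ∪-⊆ G K _ (⊆-∪ˡ G (H ∪ᶠ K)) (λ v Kv → ⊆-∪ʳ G (H ∪ᶠ K) v (⊆-∪ʳ H K v Kv))

  module _ (_≟_ : DecidableEquality V) where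

    ∈-singleton : (v : V) → v ∈ᶠ singleton _≟_ v
    ∈-singleton v = ⌊⌋-true (v ≟ v) refl

    singleton-⊆ : (v : V) (K : Face {V}) → v ∈ᶠ K → singleton _≟_ v ⊆ᶠ K
    singleton-⊆ v K Kv w w∈ with ⌊⌋-sound (w ≟ v) w∈
    ... | refl = Kv

module _ {n : ℕ} {c : Fin n → ℕ} where

  Fc-∈ : (a : Mono n c) {k : Fin n} {j : Fin (suc (c k))} → j ≢ a k → (k , j) ∈ᶠ Fc a
  Fc-∈ a {k} {j} j≢ = cong not (⌊⌋-false (j FinP.≟ a k) j≢)

  Fc-∉ : (a : Mono n c) (k : Fin n) → Fc a (k , a k) ≡ false
  Fc-∉ a k = cong not (⌊⌋-true (a k FinP.≟ a k) refl)

  Fc-∈⇒≢ : (a : Mono n c) {k : Fin n} {j : Fin (suc (c k))} → (k , j) ∈ᶠ Fc a → j ≢ a k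
  Fc-∈⇒≢ a {k} j∈ refl with trans (sym j∈) (Fc-∉ a k)
  ... | ()

  Fc-cong : (a b : Mono n c) → (∀ k → a k ≡ b k) → ∀ v → Fc a v ≡ Fc b v
  Fc-cong a b a≗b (k , j) rewrite a≗b k = refl

  Fc-⊆⇒≗ : (a b : Mono n c) → Fc a ⊆ᶠ Fc b → ∀ k → b k ≡ a k
  Fc-⊆⇒≗ a b a⊆b k with b k FinP.≟ a k
  ... | yes b≡a = b≡a
  ... | no  b≢a with trans (sym (a⊆b (k , b k) (Fc-∈ a b≢a))) (Fc-∉ b k)
  ...   | ()

  Fc-mix : (H : Face {Vtx n c}) (e f x : Mono n c) → H ⊆ᶠ Fc e → H ⊆ᶠ Fc f →
           (∀ k → x k ≡ e k ⊎ x k ≡ f k) → H ⊆ᶠ Fc x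
  Fc-mix H e f x H⊆e H⊆f x∈ef (k , j) Hv with x∈ef k
  ... | inj₁ x≡e = Fc-∈ x (λ j≡ → Fc-∈⇒≢ e (H⊆e _ Hv) (trans j≡ x≡e))
  ... | inj₂ x≡f = Fc-∈ x (λ j≡ → Fc-∈⇒≢ f (H⊆f _ Hv) (trans j≡ x≡f))

  ⁅⁆⊆Fc : (x : Mono n c) (k : Fin n) (j : Fin (suc (c k))) → j ≢ x k → ⁅ k , j ⁆ ⊆ᶠ Fc x
  ⁅⁆⊆Fc x k j j≢ = singleton-⊆ Vtx-dec (k , j) (Fc x) (Fc-∈ x j≢)

  avoid-∪⁻ : (G : Face {Vtx n c}) (x : Mono n c) (k : Fin n) (j : Fin (suc (c k))) →
             (G ∪ᶠ ⁅ k , j ⁆) ⊆ᶠ Fc x → G ⊆ᶠ Fc x × j ≢ x k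
  avoid-∪⁻ G x k j ⊆x =
    (λ v Gv → ⊆x v (⊆-∪ˡ G ⁅ k , j ⁆ v Gv)) ,
    Fc-∈⇒≢ x (⊆x (k , j) (⊆-∪ʳ G ⁅ k , j ⁆ (k , j) (∈-singleton Vtx-dec (k , j))))

  ≗⇒∣ᵐ : (a b : Mono n c) → (∀ k → b k ≡ a k) → b ∣ᵐ a
  ≗⇒∣ᵐ a b b≗a k = ≤-reflexive (cong toℕ (b≗a k))

  ≗-from-coord : (a b : Mono n c) (i : Fin n) → (∀ k → k ≢ i → a k ≡ b k) → a i ≡ b i → ∀ k → a k ≡ b k
  ≗-from-coord a b i off at k with k FinP.≟ i
  ... | yes refl = at
  ... | no k≢i   = off k k≢i

  update : Mono n c → (i : Fin n) → Fin (suc (c i)) → Mono n c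
  update a i j k with k FinP.≟ i
  ... | yes refl = j
  ... | no _     = a k

  update-≡ : (a : Mono n c) (i : Fin n) (j : Fin (suc (c i))) → update a i j i ≡ j
  update-≡ a i j with i FinP.≟ i
  ... | yes refl = refl
  ... | no i≢i   = contradiction refl i≢i

  update-≢ : (a : Mono n c) (i : Fin n) (j : Fin (suc (c i))) (k : Fin n) → k ≢ i → update a i j k ≡ a k
  update-≢ a i j k k≢i with k FinP.≟ i
  ... | yes k≡i = contradiction k≡i k≢i
  ... | no _    = refl

  update-either : (x y : Mono n c) (i : Fin n) (j : Fin (suc (c i))) → j ≡ x i ⊎ j ≡ y i →
                  ∀ k → update y i j k ≡ x k ⊎ update y i j k ≡ y k
  update-either x y i j j∈xy k = by-coord (k FinP.≟ i)
    where
    by-coord : Dec (k ≡ i) → update y i j k ≡ x k ⊎ update y i j k ≡ y k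
    by-coord (yes refl) = ⊎-map (trans (update-≡ y k j)) (trans (update-≡ y k j)) j∈xy
    by-coord (no k≢i) = inj₂ (update-≢ y i j k k≢i)

  update-∣ : (a : Mono n c) (i : Fin n) (j : Fin (suc (c i))) → toℕ j ≤ toℕ (a i) → update a i j ∣ᵐ a
  update-∣ a i j j≤ai k = by-coord (k FinP.≟ i)
    where
    by-coord : Dec (k ≡ i) → toℕ (update a i j k) ≤ toℕ (a k)
    by-coord (yes refl) = subst (λ t → toℕ t ≤ toℕ (a k)) (sym (update-≡ a k j)) j≤ai
    by-coord (no k≢i)   = ≤-reflexive (cong toℕ (update-≢ a i j k k≢i))

  ∣-update : (a : Mono n c) (i : Fin n) (j : Fin (suc (c i))) → toℕ (a i) ≤ toℕ j → a ∣ᵐ update a i j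
  ∣-update a i j ai≤j k = by-coord (k FinP.≟ i)
    where
    by-coord : Dec (k ≡ i) → toℕ (a k) ≤ toℕ (update a i j k)
    by-coord (yes refl) = subst (λ t → toℕ (a k) ≤ toℕ t) (sym (update-≡ a k j)) ai≤j
    by-coord (no k≢i)   = ≤-reflexive (cong toℕ (sym (update-≢ a i j k k≢i)))

  splice : ℕ → Mono n c → Mono n c → Mono n c
  splice t e f k with toℕ k <? t
  ... | yes _ = f k
  ... | no _  = e k

  splice-either : ∀ t e f k → splice t e f k ≡ e k ⊎ splice t e f k ≡ f k
  splice-either t e f k with toℕ k <? t
  ... | yes _ = inj₂ refl
  ... | no _  = inj₁ refl

  splice-none : ∀ e f k → splice 0 e f k ≡ e k
  splice-none e f k with toℕ k <? 0
  ... | no _ = refl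

  splice-all : ∀ e f k → splice n e f k ≡ f k
  splice-all e f k with toℕ k <? n
  ... | yes _   = refl
  ... | no k≮n  = contradiction (FinP.toℕ<n k) k≮n

  splice-step : ∀ t e f (t<n : t < n) k → k ≢ fromℕ< t<n → splice (suc t) e f k ≡ splice t e f k
  splice-step t e f t<n k k≢t with toℕ k <? suc t | toℕ k <? t
  ... | yes _   | yes _   = refl
  ... | no _    | no _    = refl
  ... | no k≮1+t | yes k<t = contradiction (≤-trans k<t (n≤1+n t)) k≮1+t
  ... | yes k<1+t | no k≮t = contradiction k≡t k≢t
    where
    k≡t : k ≡ fromℕ< t<n
    k≡t = FinP.toℕ-injective (trans (≤-antisym (≤-pred k<1+t) (≮⇒≥ k≮t)) (sym (FinP.toℕ-fromℕ< t<n)))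

  update-⊆Fc : (R : Face {Vtx n c}) (a : Mono n c) (i : Fin n) (j : Fin (suc (c i))) →
               R ⊆ᶠ Fc a → R (i , j) ≡ false → R ⊆ᶠ Fc (update a i j)
  update-⊆Fc R a i j R⊆a j∉R (k , j′) j′∈R = by-coord (k FinP.≟ i)
    where
    by-coord : Dec (k ≡ i) → (k , j′) ∈ᶠ Fc (update a i j)
    by-coord (no k≢i) =
      Fc-∈ (update a i j) (λ j′≡ → Fc-∈⇒≢ a (R⊆a _ j′∈R) (trans j′≡ (update-≢ a i j k k≢i)))
    by-coord (yes refl) = Fc-∈ (update a i j) (λ j′≡ → j′≢j (trans j′≡ (update-≡ a i j)))
      where
      j′≢j : j′ ≢ j
      j′≢j refl with trans (sym j′∈R) j∉R
      ... | ()

  -- If b differs from a exactly in coordinate i, then F_c(a) ∩ F_c(b) is F_c(a) minus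
  -- the single vertex (i , b_i); hence it has one vertex fewer than a facet.
  card-ridge : (a b : Mono n c) (i : Fin n) → (∀ k → k ≢ i → b k ≡ a k) → b i ≢ a i →
    card (allVtx n c) (λ v → Fc a v ∧ Fc b v) ≡ length (allVtx n c) ∸ n ∸ 1
  card-ridge a b i agree bi≢ai = begin
    card V ridge                                  ≡⟨ card-ext V ridge≗ ⟩
    card V punctured                              ≡⟨ sym (m+n∸n≡m (card V punctured) 1) ⟩
    card V punctured + 1 ∸ 1                      ≡⟨ cong (λ k → card V punctured + k ∸ 1) (sym (card-vertex p)) ⟩
    card V punctured + card V ⁅ p ⁆ ∸ 1           ≡⟨ cong (_∸ 1) (card-remove Vtx-dec V (Fc a) (Fc-∈ a bi≢ai)) ⟩
    card V (Fc a) ∸ 1                             ≡⟨ cong (_∸ 1) (card-Fc a) ⟩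
    length V ∸ n ∸ 1                              ∎
    where
    open ≡-Reasoning
    open Counting
    V : List (Vtx n c)
    V = allVtx n c
    p : Vtx n c
    p = (i , b i)
    ridge punctured : Face {Vtx n c}
    ridge v = Fc a v ∧ Fc b v
    punctured v = Fc a v ∧ not (⁅ p ⁆ v)
    ridge≗′ : ∀ k j → Dec (k ≡ i) → ridge (k , j) ≡ punctured (k , j)
    ridge≗′ k j (yes refl) = cong (λ t → Fc a (k , j) ∧ not t) (sym (⁅⁆-fibre k j (b k)))
    ridge≗′ k j (no k≢i) = begin
      Fc a (k , j) ∧ Fc b (k , j)   ≡⟨ cong (Fc a (k , j) ∧_) (cong (λ t → not ⌊ j FinP.≟ t ⌋) (agree k k≢i)) ⟩
      Fc a (k , j) ∧ Fc a (k , j)   ≡⟨ ∧-idem _ ⟩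
      Fc a (k , j)                  ≡⟨ sym (∧-identityʳ _) ⟩
      Fc a (k , j) ∧ true           ≡⟨ cong (λ t → Fc a (k , j) ∧ not t) (sym (⁅⁆-off p k j k≢i)) ⟩
      punctured (k , j)             ∎
    ridge≗ : ∀ v → ridge v ≡ punctured v
    ridge≗ (k , j) = ridge≗′ k j (k FinP.≟ i)

  ridge-⊆Fc : (a b x : Mono n c) → (λ v → Fc a v ∧ Fc b v) ⊆ᶠ Fc x → ∀ k → x k ≡ a k ⊎ x k ≡ b k
  ridge-⊆Fc a b x ridge⊆x k with x k FinP.≟ a k | x k FinP.≟ b k
  ... | yes x≡a | _       = inj₁ x≡a
  ... | no _    | yes x≡b = inj₂ x≡b
  ... | no x≢a  | no x≢b with trans (sym (ridge⊆x (k , x k) both)) (Fc-∉ x k)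
    where
    both : Fc a (k , x k) ∧ Fc b (k , x k) ≡ true
    both rewrite Fc-∈ a x≢a | Fc-∈ b x≢b = refl
  ...   | ()

module BierFaces {n : ℕ} {c : Fin n → ℕ} {M : Mono n c → Set} (isMC : IsMulticomplex M) where
  open IsMulticomplex isMC

  Fc-isFacet : (a : Mono n c) → M a → IsFacet (Bcx M) (Fc a)
  Fc-isFacet a Ma = (a , Ma , λ v v∈ → v∈) , maximal
    where
    maximal : ∀ G → Bcx M G → Fc a ⊆ᶠ G → G ⊆ᶠ Fc a
    maximal G (b , _ , G⊆b) a⊆G v Gv =
      trans (Fc-cong a b (λ k → sym (Fc-⊆⇒≗ a b (λ w a∋w → G⊆b w (a⊆G w a∋w)) k)) v) (G⊆b v Gv)

  isFacet⇒Fc : ∀ F → IsFacet (Bcx M) F → Σ (Mono n c) λ a → M a × F ≐ Fc a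
  isFacet⇒Fc F ((a , Ma , F⊆a) , maximal) = a , Ma , F⊆a , maximal (Fc a) (a , Ma , λ v v∈ → v∈) F⊆a

  record Bridge (G : Face {Vtx n c}) : Set where
    constructor bridge
    field
      inside outside : Mono n c
      coord          : Fin n
      inside∈M       : M inside
      outside∉M      : ¬ M outside
      agree          : ∀ k → k ≢ coord → outside k ≡ inside k
      inside-avoids  : G ⊆ᶠ Fc inside
      outside-avoids : G ⊆ᶠ Fc outside

  Bier-⊆ : ∀ G H → G ⊆ᶠ H → Bier n c M H → Bier n c M G
  Bier-⊆ G H G⊆H (R , R∈ , cardR , H⊆R , facet) = R , R∈ , cardR , (λ v Gv → H⊆R v (G⊆H v Gv)) , facet

  -- The ridge F_c(a) ∩ F_c(b) of a bridge lies in the single facet F_c(a).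
  Bridge⇒Bier : ∀ G → Bridge G → Bier n c M G
  Bridge⇒Bier G (bridge a b i Ma b∉M agree G⊆a G⊆b) =
    ridge , (a , Ma , ridge⊆a) , card-ridge a b i agree bi≢ai , G⊆ridge ,
    Fc a , Fc-isFacet a Ma , ridge⊆a , unique
    where
    ridge : Face {Vtx n c}
    ridge v = Fc a v ∧ Fc b v
    ridge⊆a : ridge ⊆ᶠ Fc a
    ridge⊆a v v∈ with Fc a v
    ... | true = refl
    G⊆ridge : G ⊆ᶠ ridge
    G⊆ridge v Gv rewrite G⊆a v Gv | G⊆b v Gv = refl
    bi≢ai : b i ≢ a i
    bi≢ai bi≡ai = b∉M (closed a b Ma (≗⇒∣ᵐ a b (≗-from-coord b a i agree bi≡ai)))
    -- a monomial of M taking each exponent from a or b is a, since b ∉ M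
    pinned : ∀ x → M x → (∀ k → x k ≡ a k ⊎ x k ≡ b k) → ∀ k → x k ≡ a k
    pinned x Mx x∈ab = at-i (x∈ab i)
      where
      off-i : ∀ k → k ≢ i → x k ≡ a k
      off-i k k≢i with x∈ab k
      ... | inj₁ xk≡ak = xk≡ak
      ... | inj₂ xk≡bk = trans xk≡bk (agree k k≢i)
      at-i : x i ≡ a i ⊎ x i ≡ b i → ∀ k → x k ≡ a k
      at-i (inj₁ xi≡ai) = ≗-from-coord x a i off-i xi≡ai
      at-i (inj₂ xi≡bi) = contradiction (closed x b Mx (≗⇒∣ᵐ x b b≗x)) b∉M
        where
        b≗x : ∀ k → b k ≡ x k
        b≗x = ≗-from-coord b x i (λ k k≢i → trans (agree k k≢i) (sym (off-i k k≢i))) (sym xi≡bi)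
    unique : ∀ F′ → IsFacet (Bcx M) F′ → ridge ⊆ᶠ F′ → F′ ≐ Fc a
    unique F′ F′-facet ridge⊆F′ with isFacet⇒Fc F′ F′-facet
    ... | x , Mx , F′⊆x , x⊆F′ =
      (λ v v∈ → trans (sym (x≐a v)) (F′⊆x v v∈)) , (λ v v∈ → x⊆F′ v (trans (x≐a v) v∈))
      where
      x≐a : ∀ v → Fc x v ≡ Fc a v
      x≐a = Fc-cong x a (pinned x Mx (ridge-⊆Fc a b x (λ v v∈ → F′⊆x v (ridge⊆F′ v v∈))))

  -- Properness forces facets to be nonempty: some b ∉ M differs from a ∈ M somewhere.
  facet-inhabited : Proper M → (a : Mono n c) → M a → 0 < card (allVtx n c) (Fc a)
  facet-inhabited (b , b∉M) a Ma with FinP.all? (λ k → b k FinP.≟ a k)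
  ... | yes b≗a = contradiction (closed a b Ma (≗⇒∣ᵐ a b b≗a)) b∉M
  ... | no b≉a with FinP.¬∀⟶∃¬ n _ (λ k → b k FinP.≟ a k) b≉a
  ...   | k , bk≢ak = Counting.card-pos (Fc a) (∈-allVtx (k , b k)) (Fc-∈ a bk≢ak)

  -- A ridge R ⊂ F_c(a) in one facet only misses some vertex (i , j) of F_c(a); moving the
  -- i-th exponent of a to j gives a monomial outside M, since F_c of it would be a
  -- second facet containing R.
  Bier⇒Bridge : Proper M → ∀ G → Bier n c M G → Bridge G
  Bier⇒Bridge proper G (R , (a , Ma , R⊆a) , cardR , G⊆R , F , F-facet , R⊆F , unique)
    with Counting.card-witness (allVtx n c) R (Fc a) R-smaller
    where
    R-smaller : card (allVtx n c) R < card (allVtx n c) (Fc a)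
    R-smaller = begin-strict
      card (allVtx n c) R           ≡⟨ cardR ⟩
      length (allVtx n c) ∸ n ∸ 1   <⟨ ∸-monoʳ-< (s≤s z≤n) (subst (0 <_) (card-Fc a) (facet-inhabited proper a Ma)) ⟩
      length (allVtx n c) ∸ n       ≡⟨ sym (card-Fc a) ⟩
      card (allVtx n c) (Fc a)      ∎
      where open ≤-Reasoning
  ... | (i , j) , j∈a , j∉R =
    bridge a b i Ma b∉M (update-≢ a i j) (λ v Gv → R⊆a v (G⊆R v Gv)) (λ v Gv → R⊆b v (G⊆R v Gv))
    where
    b : Mono n c
    b = update a i j
    R⊆b : R ⊆ᶠ Fc b
    R⊆b = update-⊆Fc R a i j R⊆a j∉R
    b∉M : ¬ M b
    b∉M Mb = Fc-∈⇒≢ a j∈a (trans (sym (update-≡ a i j)) (Fc-⊆⇒≗ a b a⊆b i))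
      where
      a⊆b : Fc a ⊆ᶠ Fc b
      a⊆b v v∈ = proj₂ (unique (Fc b) (Fc-isFacet b Mb) R⊆b) v
                   (proj₁ (unique (Fc a) (Fc-isFacet a Ma) R⊆a) v v∈)

  -- Walking from e ∈ M to f ∉ M one coordinate at a time crosses the boundary of M
  -- somewhere; every step avoids the faces avoided by both e and f.
  bridge-between : ∀ H e f → M e → ¬ M f → H ⊆ᶠ Fc e → H ⊆ᶠ Fc f → Bridge H
  bridge-between H e f Me f∉M H⊆e H⊆f = walk n ≤-refl splice-all∉M
    where
    avoids : ∀ t → H ⊆ᶠ Fc (splice t e f)
    avoids t = Fc-mix H e f (splice t e f) H⊆e H⊆f (splice-either t e f)
    splice-all∉M : ¬ M (splice n e f)
    splice-all∉M M-all = f∉M (closed _ f M-all (≗⇒∣ᵐ _ f (λ k → sym (splice-all e f k))))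
    walk : ∀ t → t ≤ n → ¬ M (splice t e f) → Bridge H
    walk zero _ ∉M = contradiction (closed e _ Me (≗⇒∣ᵐ e _ (splice-none e f))) ∉M
    walk (suc t) t<n ∉M with decide (splice t e f)
    ... | no ∉M′ = walk t (<⇒≤ t<n) ∉M′
    ... | yes ∈M = bridge (splice t e f) (splice (suc t) e f) (fromℕ< t<n) ∈M ∉M
                          (splice-step t e f t<n) (avoids t) (avoids (suc t))

module TwoVertices (m : ℕ) (c : Fin (suc (suc m)) → ℕ) {M : Mono (suc (suc m)) c → Set}
                   (isMC : IsMulticomplex M) (proper : Proper M) where
  open IsMulticomplex isMC
  open BierFaces isMC

  N : ℕ
  N = suc (suc m)

  last : Fin N
  last = fromℕ (suc m)

  u w : Vtx N c
  u = (zero , fromℕ (c zero))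
  w = (last , zero)

  -- Bridges for G ∪ {u} and G ∪ {w} combine into one for G ∪ {u, w}: lower the first
  -- exponent of the inside monomial for w below the top, raise the last exponent of the
  -- outside monomial for u above zero, and walk between the two.
  join-bridges : ∀ G → Bridge (G ∪ᶠ ⁅ u ⁆) → Bridge (G ∪ᶠ ⁅ w ⁆) → Bridge (G ∪ᶠ (⁅ u ⁆ ∪ᶠ ⁅ w ⁆))
  join-bridges G (bridge a₁ b₁ _ a₁∈M b₁∉M _ a₁-avoids b₁-avoids)
                 (bridge a₂ b₂ _ a₂∈M b₂∉M _ a₂-avoids b₂-avoids) =
    bridge-between (G ∪ᶠ (⁅ u ⁆ ∪ᶠ ⁅ w ⁆)) e f e∈M f∉M
      (avoids e e-avoids-G e-avoids-u e-avoids-w) (avoids f f-avoids-G f-avoids-u f-avoids-w)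
    where
    avoid-u : ∀ x → (G ∪ᶠ ⁅ u ⁆) ⊆ᶠ Fc x → G ⊆ᶠ Fc x × fromℕ (c zero) ≢ x zero
    avoid-u x = avoid-∪⁻ G x zero (fromℕ (c zero))
    avoid-w : ∀ x → (G ∪ᶠ ⁅ w ⁆) ⊆ᶠ Fc x → G ⊆ᶠ Fc x × zero ≢ x last
    avoid-w x = avoid-∪⁻ G x last zero
    lowered : Fin (suc (c zero))
    lowered = a₁ zero ⊓ᶠ a₂ zero
    raised : Fin (suc (c last))
    raised = b₂ last ⊔ᶠ b₁ last
    e f : Mono N c
    e = update a₂ zero lowered
    f = update b₁ last raised
    e∈M : M e
    e∈M = closed a₂ e a₂∈M (update-∣ a₂ zero lowered (⊓ᶠ-≤ʳ (a₁ zero) (a₂ zero)))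
    f∉M : ¬ M f
    f∉M f∈M = b₁∉M (closed f b₁ f∈M (∣-update b₁ last raised (⊔ᶠ-≥ʳ (b₂ last) (b₁ last))))
    e-avoids-G : G ⊆ᶠ Fc e
    e-avoids-G = Fc-mix G a₁ a₂ e (proj₁ (avoid-u a₁ a₁-avoids)) (proj₁ (avoid-w a₂ a₂-avoids))
                   (update-either a₁ a₂ zero lowered (⊓ᶠ-either (a₁ zero) (a₂ zero)))
    f-avoids-G : G ⊆ᶠ Fc f
    f-avoids-G = Fc-mix G b₂ b₁ f (proj₁ (avoid-w b₂ b₂-avoids)) (proj₁ (avoid-u b₁ b₁-avoids))
                   (update-either b₂ b₁ last raised (⊔ᶠ-either (b₂ last) (b₁ last)))
    e-avoids-u : fromℕ (c zero) ≢ e zero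
    e-avoids-u = subst (fromℕ (c zero) ≢_) (sym (update-≡ a₂ zero lowered))
                   (below-top (a₁ zero) lowered (⊓ᶠ-≤ˡ (a₁ zero) (a₂ zero)) (proj₂ (avoid-u a₁ a₁-avoids)))
    e-avoids-w : zero ≢ e last
    e-avoids-w = subst (zero ≢_) (sym (update-≢ a₂ zero lowered last λ ())) (proj₂ (avoid-w a₂ a₂-avoids))
    f-avoids-u : fromℕ (c zero) ≢ f zero
    f-avoids-u = subst (fromℕ (c zero) ≢_) (sym (update-≢ b₁ last raised zero λ ())) (proj₂ (avoid-u b₁ b₁-avoids))
    f-avoids-w : zero ≢ f last
    f-avoids-w = subst (zero ≢_) (sym (update-≡ b₁ last raised))
                   (above-zero (b₂ last) raised (⊔ᶠ-≥ˡ (b₂ last) (b₁ last)) (proj₂ (avoid-w b₂ b₂-avoids)))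
    avoids : ∀ x → G ⊆ᶠ Fc x → fromℕ (c zero) ≢ x zero → zero ≢ x last →
             (G ∪ᶠ (⁅ u ⁆ ∪ᶠ ⁅ w ⁆)) ⊆ᶠ Fc x
    avoids x G⊆x x₀ x-last =
      ∪-⊆ G _ (Fc x) G⊆x (∪-⊆ ⁅ u ⁆ ⁅ w ⁆ (Fc x) (⁅⁆⊆Fc x zero _ x₀) (⁅⁆⊆Fc x last zero x-last))

  join : ∀ G → Bier N c M (G ∪ᶠ ⁅ u ⁆) → Bier N c M (G ∪ᶠ ⁅ w ⁆) →
         Bier N c M (G ∪ᶠ (⁅ u ⁆ ∪ᶠ ⁅ w ⁆))
  join G Bu Bw = Bridge⇒Bier (G ∪ᶠ (⁅ u ⁆ ∪ᶠ ⁅ w ⁆))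
    (join-bridges G (Bier⇒Bridge proper (G ∪ᶠ ⁅ u ⁆) Bu) (Bier⇒Bridge proper (G ∪ᶠ ⁅ w ⁆) Bw))

lemma4p4 : (m : ℕ) (c : Fin (suc (suc m)) → ℕ)
    (M : Mono (suc (suc m)) c → Set) →
    IsMulticomplex M → Proper M →
    Bier (suc (suc m)) c M ⁅ (zero , fromℕ (c zero)) ⁆ →
    Bier (suc (suc m)) c M ⁅ (fromℕ (suc m) , zero) ⁆ →
    Bier (suc (suc m)) c M (⁅ (zero , fromℕ (c zero)) ⁆ ∪ᶠ ⁅ (fromℕ (suc m) , zero) ⁆)
    × BierLinkCondition (suc (suc m)) c M (zero , fromℕ (c zero)) (fromℕ (suc m) , zero)
lemma4p4 m c M isMC proper Bu Bw = edge , linkCondition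
  where
  open TwoVertices m c isMC proper
  open BierFaces isMC
  -- {u, w} = ∅ ∪ {u, w}, and {u} = ∅ ∪ {u}, {w} = ∅ ∪ {w}, definitionally
  edge : Bier N c M (⁅ u ⁆ ∪ᶠ ⁅ w ⁆)
  edge = join (λ _ → false) Bu Bw
  linkCondition : BierLinkCondition N c M u w
  linkCondition G =
    (λ { ((G#u , Bu′) , (G#w , Bw′)) → ∪-disjoint G ⁅ u ⁆ ⁅ w ⁆ G#u G#w , join G Bu′ Bw′ }) ,
    Link-∪⁻ (Bier N c M) Bier-⊆ ⁅ u ⁆ ⁅ w ⁆ G
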